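{- Let $(b_j)_{j\ge0}$ be a sequence of positive integers with $b_0=1$ and $b_j\ge2$ for $j\ge1$, and let $a_j=\prod_{i=0}^{j}b_i$ (so $a_0=1$). Let $$A=\Big\{\sum_{j=0}^{n}\varepsilon_{2j}a_{2j}: n\ge0,\ \varepsilon_{2j}\in\{0,1,\dots,b_{2j+1}-1\}\Big\},\qquad B=\Big\{\sum_{j=0}^{n}\varepsilon_{2j+1}a_{2j+1}: n\ge0,\ \varepsilon_{2j+1}\in\{0,1,\dots,b_{2j+2}-1\}\Big\}.$$ For an integer $k\ge1$ let $$y_k=(b_1-1)+(b_3-1)a_2+(b_5-1)a_4+\cdots+(b_{2k-1}-1)a_{2k-2}+a_{2k},$$ $$z_k=(b_2-1)a_1+(b_4-1)a_3+\cdots+(b_{2k}-1)a_{2k-1}+a_{2k+1},$$ and for $m\ge1$ let $D_m=\sum_{i=0}^{m-1}(-1)^i\big(\prod_{j=0}^{i}b_{m-j}\big)^{ -1}$. Then $$\frac{A(y_k)B(y_k)}{y_k}=\frac{2}{1+D_{2k}},\qquad \frac{A(z_k)B(z_k)}{z_k}=\frac{2}{1+D_{2k}\!\!\!\!\phantom{|}^{*}_{+1}}\ \text{ where } D^{*}_{2k+1}=D_{2k+1}-\frac{1}{b_{2k+1}b_{2k}\cdots b_2b_1},$$ i.e. $\dfrac{A(z_k)B(z_k)}{z_k}=\dfrac{2}{1+D_{2k+1}-\frac{1}{b_{2k+1}b_{2k}\cdots b_1}}$.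
   Context: For a set $S$ of non-negative integers, $S(x)=\#\{s\in S: s\le x\}$. Sums defining elements of $A$ and $B$ are finite sums (the empty/zero sum gives $0\in A$, $0\in B$). -}

module Defs where

open import Data.Nat as ℕ using (ℕ; zero; suc; _+_; _*_; _∸_; _≤_; _<_)
open import Data.Integer using (+_)
open import Data.Rational as ℚ using (ℚ; _/_)
open import Data.List using (List; length)
open import Data.List.Membership.Propositional using (_∈_)
open import Data.List.Relation.Unary.Unique.Propositional using (Unique)
open import Data.Product using (Σ; ∃; _×_)
open import Relation.Binary.PropositionalEquality using (_≡_)

sumℕ : ℕ → (ℕ → ℕ) → ℕ
sumℕ zero    f = 0
sumℕ (suc n) f = sumℕ n f + f n

prodℕ : ℕ → (ℕ → ℕ) → ℕ
prodℕ zero    f = 1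
prodℕ (suc n) f = prodℕ n f * f n

sumℚ : ℕ → (ℕ → ℚ) → ℚ
sumℚ zero    f = ℚ.0ℚ
sumℚ (suc n) f = sumℚ n f ℚ.+ f n

alt : ℕ → ℚ
alt zero    = ℚ.1ℚ
alt (suc i) = ℚ.- alt i

-- 1/n for positive n (convention: 0 ↦ 0; only applied to positive n here)
inv : ℕ → ℚ
inv zero    = ℚ.0ℚ
inv (suc n) = + 1 / suc n

a : (ℕ → ℕ) → ℕ → ℕ
a b j = prodℕ (suc j) b

inA : (ℕ → ℕ) → ℕ → Set
inA b s = Σ ℕ λ n → Σ (ℕ → ℕ) λ ε →
  ((j : ℕ) → j ≤ n → ε j < b (suc (2 * j))) ×
  (s ≡ sumℕ (suc n) (λ j → ε j * a b (2 * j)))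

inB : (ℕ → ℕ) → ℕ → Set
inB b s = Σ ℕ λ n → Σ (ℕ → ℕ) λ ε →
  ((j : ℕ) → j ≤ n → ε j < b (2 + 2 * j)) ×
  (s ≡ sumℕ (suc n) (λ j → ε j * a b (suc (2 * j))))

-- S(x) = c : the set {s ∈ S : s ≤ x} has exactly c elements
CountIs : (ℕ → Set) → ℕ → ℕ → Set
CountIs S x c = Σ (List ℕ) λ L → Unique L × length L ≡ c ×
  ((s : ℕ) → (s ∈ L → S s × s ≤ x) × (S s × s ≤ x → s ∈ L))

y : (ℕ → ℕ) → ℕ → ℕ
y b k = sumℕ k (λ j → (b (suc (2 * j)) ∸ 1) * a b (2 * j)) + a b (2 * k)

z : (ℕ → ℕ) → ℕ → ℕ
z b k = sumℕ k (λ j → (b (2 + 2 * j) ∸ 1) * a b (suc (2 * j))) + a b (suc (2 * k))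

D : (ℕ → ℕ) → ℕ → ℚ
D b m = sumℚ m (λ i → alt i ℚ.* inv (prodℕ (suc i) (λ j → b (m ∸ j))))

Dstar : (ℕ → ℕ) → ℕ → ℚ
Dstar b k = D b (suc (2 * k)) ℚ.- inv (prodℕ (suc (2 * k)) (λ i → b (suc i)))

toℚ : ℕ → ℚ
toℚ n = + n / 1

module Submission where

-- A and B are the numbers written in two interleaved mixed-radix systems: place values a_{2j} with
-- digits below b_{2j+1}, and place values a_{2j+1} with digits below b_{2j+2}. For place values c_i
-- with digit bounds d_i ≥ 2 and d_i c_i ≤ c_{i+1}, the numbers written with the first K digits are
-- distinct, lie below c_K, and the largest of them is M_K = Σ_{i<K} (d_i − 1) c_i; so exactly
-- (e + 1) d_0 ⋯ d_{K−1} representable numbers are ≤ x whenever M_K + e c_K ≤ x < (e + 1) c_K.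
-- Since y_k = M^A_k + a_{2k} while M^B_k ≤ y_k < a_{2k+1}, we get A(y_k) B(y_k) = 2 b_1 b_2 ⋯ b_{2k} = 2 a_{2k},
-- and symmetrically A(z_k) B(z_k) = 2 a_{2k+1}. On the other side, a_m D_m = E_m := a_{m−1} − a_{m−2} + ⋯ ± a_0,
-- which satisfies E_{m+1} = a_m − E_m; telescoping the digits (b_{j+1} − 1) a_j = a_{j+1} − a_j then gives
-- y_k = a_{2k} (1 + D_{2k}) and z_k = a_{2k+1} (1 + D*_{2k+1}).

open import Data.Nat using (ℕ; suc; _≤_)
open import Relation.Binary.PropositionalEquality using (_≡_)

module ToℚProperties where
  open import Defs using (toℚ; inv)
  import Data.Nat as ℕ
  import Data.Nat.Properties as ℕₚ
  open import Data.Integer as ℤ using (+_)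
  import Data.Integer.Properties as ℤₚ
  open import Data.Rational using (toℚᵘ; 1ℚ; _+_; _*_; _-_; _÷_; 1/_; NonZero)
  open import Data.Rational.Properties
    using (toℚᵘ-injective; toℚᵘ-fromℚᵘ; toℚᵘ-homo-+; toℚᵘ-homo-*; *-identityʳ; *-inverseˡ; *-inverseʳ)
  import Data.Rational.Unnormalised as ℚᵘ
  import Data.Rational.Unnormalised.Properties as ℚᵘₚ
  open import Data.Rational.Solver using (module +-*-Solver)
  open import Relation.Binary.PropositionalEquality
  open +-*-Solver

  toℚᵘ-toℚ : ∀ n → toℚᵘ (toℚ n) ℚᵘ.≃ ℚᵘ.mkℚᵘ (+ n) 0
  toℚᵘ-toℚ n = toℚᵘ-fromℚᵘ (ℚᵘ.mkℚᵘ (+ n) 0)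

  toℚ-+ : ∀ m n → toℚ (m ℕ.+ n) ≡ toℚ m + toℚ n
  toℚ-+ m n = toℚᵘ-injective (begin
    toℚᵘ (toℚ (m ℕ.+ n))                    ≈⟨ toℚᵘ-toℚ (m ℕ.+ n) ⟩
    ℚᵘ.mkℚᵘ (+ (m ℕ.+ n)) 0                 ≈⟨ ℚᵘ.*≡* (cong (ℤ._* + 1) pos-+′) ⟩
    ℚᵘ.mkℚᵘ (+ m) 0 ℚᵘ.+ ℚᵘ.mkℚᵘ (+ n) 0    ≈⟨ ℚᵘₚ.+-cong (toℚᵘ-toℚ m) (toℚᵘ-toℚ n) ⟨
    toℚᵘ (toℚ m) ℚᵘ.+ toℚᵘ (toℚ n)          ≈⟨ toℚᵘ-homo-+ (toℚ m) (toℚ n) ⟨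
    toℚᵘ (toℚ m + toℚ n)                    ∎)
    where
    open ℚᵘₚ.≃-Reasoning
    pos-+′ : + (m ℕ.+ n) ≡ + m ℤ.* + 1 ℤ.+ + n ℤ.* + 1
    pos-+′ = trans (ℤₚ.pos-+ m n) (sym (cong₂ ℤ._+_ (ℤₚ.*-identityʳ (+ m)) (ℤₚ.*-identityʳ (+ n))))

  toℚ-* : ∀ m n → toℚ (m ℕ.* n) ≡ toℚ m * toℚ n
  toℚ-* m n = toℚᵘ-injective (begin
    toℚᵘ (toℚ (m ℕ.* n))                    ≈⟨ toℚᵘ-toℚ (m ℕ.* n) ⟩
    ℚᵘ.mkℚᵘ (+ (m ℕ.* n)) 0                 ≈⟨ ℚᵘ.*≡* (cong (ℤ._* + 1) (ℤₚ.pos-* m n)) ⟩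
    ℚᵘ.mkℚᵘ (+ m) 0 ℚᵘ.* ℚᵘ.mkℚᵘ (+ n) 0    ≈⟨ ℚᵘₚ.*-cong (toℚᵘ-toℚ m) (toℚᵘ-toℚ n) ⟨
    toℚᵘ (toℚ m) ℚᵘ.* toℚᵘ (toℚ n)          ≈⟨ toℚᵘ-homo-* (toℚ m) (toℚ n) ⟨
    toℚᵘ (toℚ m * toℚ n)                    ∎)
    where open ℚᵘₚ.≃-Reasoning

  toℚ-∸ : ∀ {m n} → n ≤ m → toℚ (m ℕ.∸ n) ≡ toℚ m - toℚ n
  toℚ-∸ {m} {n} n≤m = begin
    toℚ (m ℕ.∸ n)                      ≡⟨ solve 2 (λ x y → x := (x :+ y) :- y) refl (toℚ (m ℕ.∸ n)) (toℚ n) ⟩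
    (toℚ (m ℕ.∸ n) + toℚ n) - toℚ n    ≡⟨ cong (_- toℚ n) (toℚ-+ (m ℕ.∸ n) n) ⟨
    toℚ (m ℕ.∸ n ℕ.+ n) - toℚ n        ≡⟨ cong (λ t → toℚ t - toℚ n) (ℕₚ.m∸n+n≡m n≤m) ⟩
    toℚ m - toℚ n                      ∎
    where open ≡-Reasoning

  toℚ*inv≡1 : ∀ n → 1 ≤ n → toℚ n * inv n ≡ 1ℚ
  toℚ*inv≡1 (suc n) _ = toℚᵘ-injective (begin
    toℚᵘ (toℚ (suc n) * inv (suc n))            ≈⟨ toℚᵘ-homo-* (toℚ (suc n)) (inv (suc n)) ⟩
    toℚᵘ (toℚ (suc n)) ℚᵘ.* toℚᵘ (inv (suc n))  ≈⟨ ℚᵘₚ.*-cong (toℚᵘ-toℚ (suc n)) (toℚᵘ-fromℚᵘ (ℚᵘ.mkℚᵘ (+ 1) n)) ⟩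
    ℚᵘ.mkℚᵘ (+ suc n) 0 ℚᵘ.* ℚᵘ.mkℚᵘ (+ 1) n    ≈⟨ ℚᵘ.*≡* (cong +_ n*1*1≡1*[1*n]) ⟩
    ℚᵘ.1ℚᵘ                                      ∎)
    where
    open ℚᵘₚ.≃-Reasoning
    n*1*1≡1*[1*n] : suc n ℕ.* 1 ℕ.* 1 ≡ 1 ℕ.* (1 ℕ.* suc n)
    n*1*1≡1*[1*n] = trans (ℕₚ.*-identityʳ _) (trans (ℕₚ.*-identityʳ _) (sym (trans (ℕₚ.*-identityˡ _) (ℕₚ.*-identityˡ _))))

  toℚ-*-inv-cancelʳ : ∀ m n → 1 ≤ n → toℚ (m ℕ.* n) * inv n ≡ toℚ m
  toℚ-*-inv-cancelʳ m n 1≤n = begin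
    toℚ (m ℕ.* n) * inv n       ≡⟨ cong (_* inv n) (toℚ-* m n) ⟩
    toℚ m * toℚ n * inv n       ≡⟨ solve 3 (λ x y z → x :* y :* z := x :* (y :* z)) refl (toℚ m) (toℚ n) (inv n) ⟩
    toℚ m * (toℚ n * inv n)     ≡⟨ cong (toℚ m *_) (toℚ*inv≡1 n 1≤n) ⟩
    toℚ m * 1ℚ                  ≡⟨ *-identityʳ (toℚ m) ⟩
    toℚ m                       ∎
    where open ≡-Reasoning

  toℚ-*-÷-cancel : ∀ l m N {R} → toℚ N ≡ toℚ m * R → .{{_ : NonZero (toℚ N)}} → .{{_ : NonZero R}} →
                   toℚ (l ℕ.* m) ÷ toℚ N ≡ toℚ l ÷ R
  toℚ-*-÷-cancel l m N {R} N≡m*R = begin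
    toℚ (l ℕ.* m) * 1/ toℚ N                  ≡⟨ cong (_* 1/ toℚ N) (toℚ-* l m) ⟩
    toℚ l * toℚ m * 1/ toℚ N                  ≡⟨ *-identityʳ _ ⟨
    toℚ l * toℚ m * 1/ toℚ N * 1ℚ             ≡⟨ cong (toℚ l * toℚ m * 1/ toℚ N *_) (*-inverseʳ R) ⟨
    toℚ l * toℚ m * 1/ toℚ N * (R * 1/ R)     ≡⟨ solve 5 (λ x y w r v → x :* y :* w :* (r :* v) := x :* v :* (w :* (y :* r)))
                                                   refl (toℚ l) (toℚ m) (1/ toℚ N) R (1/ R) ⟩
    toℚ l * 1/ R * (1/ toℚ N * (toℚ m * R))   ≡⟨ cong (λ t → toℚ l * 1/ R * (1/ toℚ N * t)) N≡m*R ⟨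
    toℚ l * 1/ R * (1/ toℚ N * toℚ N)         ≡⟨ cong (toℚ l * 1/ R *_) (*-inverseˡ (toℚ N)) ⟩
    toℚ l * 1/ R * 1ℚ                         ≡⟨ *-identityʳ _ ⟩
    toℚ l * 1/ R                              ∎
    where open ≡-Reasoning

module SumProperties where
  open import Defs using (sumℕ; prodℕ; sumℚ)
  open import Data.Nat using (zero; _+_; _*_; _<_; z≤n)
  open import Data.Nat.Properties
  open import Data.Rational as ℚ using (-_)
  import Data.Rational.Properties as ℚₚ
  open import Data.Sum using (inj₁; inj₂)
  open import Relation.Binary.PropositionalEquality

  sumℕ-cong : ∀ n {f g} → (∀ i → i < n → f i ≡ g i) → sumℕ n f ≡ sumℕ n g
  sumℕ-cong zero    f≡g = refl
  sumℕ-cong (suc n) f≡g = cong₂ _+_ (sumℕ-cong n λ i i<n → f≡g i (m<n⇒m<1+n i<n)) (f≡g n (n<1+n n))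

  sumℕ-mono-≤ : ∀ n {f g} → (∀ i → i < n → f i ≤ g i) → sumℕ n f ≤ sumℕ n g
  sumℕ-mono-≤ zero    f≤g = z≤n
  sumℕ-mono-≤ (suc n) f≤g = +-mono-≤ (sumℕ-mono-≤ n λ i i<n → f≤g i (m<n⇒m<1+n i<n)) (f≤g n (n<1+n n))

  term≤sumℕ : ∀ n f {i} → i < n → f i ≤ sumℕ n f
  term≤sumℕ (suc n) f {i} i<1+n with m<1+n⇒m<n∨m≡n i<1+n
  ... | inj₁ i<n  = ≤-trans (term≤sumℕ n f i<n) (m≤m+n (sumℕ n f) (f n))
  ... | inj₂ refl = m≤n+m (f i) (sumℕ n f)

  sumℕ-vanishing : ∀ {L f} → (∀ i → L ≤ i → f i ≡ 0) → ∀ {N} → L ≤ N → sumℕ N f ≡ sumℕ L f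
  sumℕ-vanishing f≡0 {zero}  z≤n = refl
  sumℕ-vanishing {L} {f} f≡0 {suc N} L≤1+N with m≤n⇒m<n∨m≡n L≤1+N
  ... | inj₂ refl   = refl
  ... | inj₁ L<1+N = begin
    sumℕ N f + f N   ≡⟨ cong₂ _+_ (sumℕ-vanishing f≡0 (m<1+n⇒m≤n L<1+N)) (f≡0 N (m<1+n⇒m≤n L<1+N)) ⟩
    sumℕ L f + 0     ≡⟨ +-identityʳ (sumℕ L f) ⟩
    sumℕ L f         ∎
    where open ≡-Reasoning

  1≤prodℕ : ∀ n f → (∀ i → 1 ≤ f i) → 1 ≤ prodℕ n f
  1≤prodℕ zero    f 1≤f = ≤-refl
  1≤prodℕ (suc n) f 1≤f = *-mono-≤ (1≤prodℕ n f 1≤f) (1≤f n)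

  prodℕ-suc : ∀ n f → prodℕ (suc n) f ≡ f 0 * prodℕ n (λ i → f (suc i))
  prodℕ-suc zero    f = trans (*-identityˡ (f 0)) (sym (*-identityʳ (f 0)))
  prodℕ-suc (suc n) f = trans (cong (_* f (suc n)) (prodℕ-suc n f)) (*-assoc (f 0) _ _)

  sumℚ-cong : ∀ n {f g} → (∀ i → i < n → f i ≡ g i) → sumℚ n f ≡ sumℚ n g
  sumℚ-cong zero    f≡g = refl
  sumℚ-cong (suc n) f≡g = cong₂ ℚ._+_ (sumℚ-cong n λ i i<n → f≡g i (m<n⇒m<1+n i<n)) (f≡g n (n<1+n n))

  sumℚ-suc : ∀ n f → sumℚ (suc n) f ≡ f 0 ℚ.+ sumℚ n (λ i → f (suc i))
  sumℚ-suc zero    f = trans (ℚₚ.+-identityˡ (f 0)) (sym (ℚₚ.+-identityʳ (f 0)))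
  sumℚ-suc (suc n) f = trans (cong (ℚ._+ f (suc n)) (sumℚ-suc n f)) (ℚₚ.+-assoc (f 0) _ _)

  sumℚ-neg : ∀ n f → sumℚ n (λ i → - f i) ≡ - sumℚ n f
  sumℚ-neg zero    f = refl
  sumℚ-neg (suc n) f = trans (cong (ℚ._+ - f n) (sumℚ-neg n f)) (sym (ℚₚ.neg-distrib-+ (sumℚ n f) (f n)))

  *-distribˡ-sumℚ : ∀ p n f → p ℚ.* sumℚ n f ≡ sumℚ n (λ i → p ℚ.* f i)
  *-distribˡ-sumℚ p zero    f = ℚₚ.*-zeroʳ p
  *-distribˡ-sumℚ p (suc n) f = trans (ℚₚ.*-distribˡ-+ p (sumℚ n f) (f n)) (cong (ℚ._+ p ℚ.* f n) (*-distribˡ-sumℚ p n f))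

module AlternatingSums (b : ℕ → ℕ) (b₀≡1 : b 0 ≡ 1) (1≤b : ∀ j → 1 ≤ b j) where
  open import Defs
  open import Data.Nat as ℕ using (zero; _∸_; s≤s; >-nonZero)
  import Data.Nat.Properties as ℕₚ
  open import Data.Rational using (ℚ; 1ℚ; _+_; _*_; -_; _-_)
  import Data.Rational.Properties as ℚₚ
  open import Data.Rational.Solver using (module +-*-Solver)
  open import Relation.Binary.PropositionalEquality
  open ToℚProperties
  open SumProperties
  open +-*-Solver

  prodDown : ℕ → ℕ → ℕ
  prodDown m i = prodℕ (suc i) (λ j → b (m ∸ j))

  alternatingSum : ℕ → ℚ
  alternatingSum m = sumℚ m (λ i → alt i * toℚ (a b (m ∸ suc i)))

  yDigits : ℕ → ℕ
  yDigits k = sumℕ k (λ j → (b (suc (2 ℕ.* j)) ∸ 1) ℕ.* a b (2 ℕ.* j))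

  zDigits : ℕ → ℕ
  zDigits k = sumℕ k (λ j → (b (2 ℕ.+ 2 ℕ.* j) ∸ 1) ℕ.* a b (suc (2 ℕ.* j)))

  a≡a*prodDown : ∀ {m i} → i ℕ.< m → a b m ≡ a b (m ∸ suc i) ℕ.* prodDown m i
  a≡a*prodDown {suc m} {zero}  _         = cong (a b m ℕ.*_) (sym (ℕₚ.*-identityˡ (b (suc m))))
  a≡a*prodDown {suc m} {suc i} (s≤s i<m) = begin
    a b m ℕ.* b (suc m)                                 ≡⟨ cong (ℕ._* b (suc m)) (a≡a*prodDown i<m) ⟩
    a b (m ∸ suc i) ℕ.* prodDown m i ℕ.* b (suc m)      ≡⟨ ℕₚ.*-assoc (a b (m ∸ suc i)) (prodDown m i) (b (suc m)) ⟩
    a b (m ∸ suc i) ℕ.* (prodDown m i ℕ.* b (suc m))    ≡⟨ cong (a b (m ∸ suc i) ℕ.*_) prodDown-suc ⟩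
    a b (m ∸ suc i) ℕ.* prodDown (suc m) (suc i)        ∎
    where
    open ≡-Reasoning
    prodDown-suc : prodDown m i ℕ.* b (suc m) ≡ prodDown (suc m) (suc i)
    prodDown-suc = trans (ℕₚ.*-comm (prodDown m i) (b (suc m))) (sym (prodℕ-suc (suc i) (λ j → b (suc m ∸ j))))

  a*D≡alternatingSum : ∀ m → toℚ (a b m) * D b m ≡ alternatingSum m
  a*D≡alternatingSum m = trans (*-distribˡ-sumℚ (toℚ (a b m)) m _) (sumℚ-cong m term)
    where
    open ≡-Reasoning
    term : ∀ i → i ℕ.< m → toℚ (a b m) * (alt i * inv (prodDown m i)) ≡ alt i * toℚ (a b (m ∸ suc i))
    term i i<m = begin
      toℚ (a b m) * (alt i * inv (prodDown m i))
        ≡⟨ solve 3 (λ x s p → x :* (s :* p) := s :* (x :* p)) refl (toℚ (a b m)) (alt i) (inv (prodDown m i)) ⟩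
      alt i * (toℚ (a b m) * inv (prodDown m i))
        ≡⟨ cong (λ t → alt i * (toℚ t * inv (prodDown m i))) (a≡a*prodDown i<m) ⟩
      alt i * (toℚ (a b (m ∸ suc i) ℕ.* prodDown m i) * inv (prodDown m i))
        ≡⟨ cong (alt i *_) (toℚ-*-inv-cancelʳ (a b (m ∸ suc i)) (prodDown m i) (1≤prodℕ (suc i) _ λ j → 1≤b _)) ⟩
      alt i * toℚ (a b (m ∸ suc i))
        ∎

  alternatingSum-suc : ∀ m → alternatingSum (suc m) ≡ toℚ (a b m) - alternatingSum m
  alternatingSum-suc m = begin
    alternatingSum (suc m)
      ≡⟨ sumℚ-suc m _ ⟩
    1ℚ * toℚ (a b m) + sumℚ m (λ i → - alt i * toℚ (a b (m ∸ suc i)))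
      ≡⟨ cong₂ _+_ (ℚₚ.*-identityˡ (toℚ (a b m))) (sumℚ-cong m λ i _ → sym (ℚₚ.neg-distribˡ-* (alt i) _)) ⟩
    toℚ (a b m) + sumℚ m (λ i → - (alt i * toℚ (a b (m ∸ suc i))))
      ≡⟨ cong (toℚ (a b m) +_) (sumℚ-neg m _) ⟩
    toℚ (a b m) - alternatingSum m
      ∎
    where open ≡-Reasoning

  alternatingSum-suc-suc : ∀ m → alternatingSum (suc (suc m)) ≡ alternatingSum m + (toℚ (a b (suc m)) - toℚ (a b m))
  alternatingSum-suc-suc m = begin
    alternatingSum (suc (suc m))                           ≡⟨ alternatingSum-suc (suc m) ⟩
    toℚ (a b (suc m)) - alternatingSum (suc m)             ≡⟨ cong (λ t → toℚ (a b (suc m)) - t) (alternatingSum-suc m) ⟩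
    toℚ (a b (suc m)) - (toℚ (a b m) - alternatingSum m)
      ≡⟨ solve 3 (λ x y e → x :- (y :- e) := e :+ (x :- y)) refl (toℚ (a b (suc m))) (toℚ (a b m)) (alternatingSum m) ⟩
    alternatingSum m + (toℚ (a b (suc m)) - toℚ (a b m))   ∎
    where open ≡-Reasoning

  toℚ-[b∸1]*a : ∀ m → toℚ ((b (suc m) ∸ 1) ℕ.* a b m) ≡ toℚ (a b (suc m)) - toℚ (a b m)
  toℚ-[b∸1]*a m = begin
    toℚ ((b (suc m) ∸ 1) ℕ.* a b m)
      ≡⟨ cong toℚ (ℕₚ.*-distribʳ-∸ (a b m) (b (suc m)) 1) ⟩
    toℚ (b (suc m) ℕ.* a b m ∸ 1 ℕ.* a b m)
      ≡⟨ cong₂ (λ s t → toℚ (s ∸ t)) (ℕₚ.*-comm (b (suc m)) (a b m)) (ℕₚ.*-identityˡ (a b m)) ⟩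
    toℚ (a b (suc m) ∸ a b m)
      ≡⟨ toℚ-∸ (ℕₚ.m≤m*n (a b m) (b (suc m)) {{>-nonZero (1≤b (suc m))}}) ⟩
    toℚ (a b (suc m)) - toℚ (a b m)
      ∎
    where open ≡-Reasoning

  toℚ-yDigits : ∀ k → toℚ (yDigits k) ≡ alternatingSum (2 ℕ.* k)
  toℚ-yDigits zero    = refl
  toℚ-yDigits (suc k) = begin
    toℚ (yDigits (suc k))
      ≡⟨ toℚ-+ (yDigits k) _ ⟩
    toℚ (yDigits k) + toℚ ((b (suc (2 ℕ.* k)) ∸ 1) ℕ.* a b (2 ℕ.* k))
      ≡⟨ cong₂ _+_ (toℚ-yDigits k) (toℚ-[b∸1]*a (2 ℕ.* k)) ⟩
    alternatingSum (2 ℕ.* k) + (toℚ (a b (suc (2 ℕ.* k))) - toℚ (a b (2 ℕ.* k)))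
      ≡⟨ alternatingSum-suc-suc (2 ℕ.* k) ⟨
    alternatingSum (suc (suc (2 ℕ.* k)))
      ≡⟨ cong alternatingSum (ℕₚ.*-suc 2 k) ⟨
    alternatingSum (2 ℕ.* suc k)
      ∎
    where open ≡-Reasoning

  toℚ-zDigits+1 : ∀ k → toℚ (zDigits k) + 1ℚ ≡ alternatingSum (suc (2 ℕ.* k))
  toℚ-zDigits+1 zero rewrite b₀≡1 = refl
  toℚ-zDigits+1 (suc k) = begin
    toℚ (zDigits (suc k)) + 1ℚ
      ≡⟨ cong (_+ 1ℚ) (toℚ-+ (zDigits k) digit) ⟩
    toℚ (zDigits k) + toℚ digit + 1ℚ
      ≡⟨ solve 3 (λ x t o → x :+ t :+ o := x :+ o :+ t) refl (toℚ (zDigits k)) (toℚ digit) 1ℚ ⟩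
    toℚ (zDigits k) + 1ℚ + toℚ digit
      ≡⟨ cong₂ _+_ (toℚ-zDigits+1 k) (toℚ-[b∸1]*a (suc (2 ℕ.* k))) ⟩
    alternatingSum (suc (2 ℕ.* k)) + (toℚ (a b (suc (suc (2 ℕ.* k)))) - toℚ (a b (suc (2 ℕ.* k))))
      ≡⟨ alternatingSum-suc-suc (suc (2 ℕ.* k)) ⟨
    alternatingSum (suc (suc (suc (2 ℕ.* k))))
      ≡⟨ cong (λ n → alternatingSum (suc n)) (ℕₚ.*-suc 2 k) ⟨
    alternatingSum (suc (2 ℕ.* suc k))
      ∎
    where
    open ≡-Reasoning
    digit : ℕ
    digit = (b (suc (suc (2 ℕ.* k))) ∸ 1) ℕ.* a b (suc (2 ℕ.* k))

  y≡a*[1+D] : ∀ k → toℚ (y b k) ≡ toℚ (a b (2 ℕ.* k)) * (1ℚ + D b (2 ℕ.* k))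
  y≡a*[1+D] k = begin
    toℚ (y b k)                                         ≡⟨ toℚ-+ (yDigits k) (a b (2 ℕ.* k)) ⟩
    toℚ (yDigits k) + toℚ (a b (2 ℕ.* k))
      ≡⟨ cong (_+ toℚ (a b (2 ℕ.* k))) (trans (toℚ-yDigits k) (sym (a*D≡alternatingSum (2 ℕ.* k)))) ⟩
    toℚ (a b (2 ℕ.* k)) * D b (2 ℕ.* k) + toℚ (a b (2 ℕ.* k))
      ≡⟨ solve 2 (λ x e → x :* e :+ x := x :* (con 1ℚ :+ e)) refl (toℚ (a b (2 ℕ.* k))) (D b (2 ℕ.* k)) ⟩
    toℚ (a b (2 ℕ.* k)) * (1ℚ + D b (2 ℕ.* k))          ∎
    where open ≡-Reasoning

  a≡prodℕ-tail : ∀ m → a b m ≡ prodℕ m (λ i → b (suc i))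
  a≡prodℕ-tail m = trans (prodℕ-suc m b) (trans (cong (ℕ._* tail) b₀≡1) (ℕₚ.*-identityˡ tail))
    where
    tail : ℕ
    tail = prodℕ m (λ i → b (suc i))

  z≡a*[1+D*] : ∀ k → toℚ (z b k) ≡ toℚ (a b (suc (2 ℕ.* k))) * (1ℚ + Dstar b k)
  z≡a*[1+D*] k = begin
    toℚ (z b k)                                 ≡⟨ toℚ-+ (zDigits k) (a b (suc (2 ℕ.* k))) ⟩
    toℚ (zDigits k) + A
      ≡⟨ solve 2 (λ t x → t :+ x := t :+ con 1ℚ :+ x :- con 1ℚ) refl (toℚ (zDigits k)) A ⟩
    toℚ (zDigits k) + 1ℚ + A - 1ℚ               ≡⟨ cong₂ (λ s t → s + A - t) zDigits≡ (sym A*inv≡1) ⟩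
    A * D b (suc (2 ℕ.* k)) + A - A * inv Q
      ≡⟨ solve 3 (λ x e i → x :* e :+ x :- x :* i := x :* (con 1ℚ :+ (e :- i))) refl A (D b (suc (2 ℕ.* k))) (inv Q) ⟩
    A * (1ℚ + Dstar b k)                        ∎
    where
    open ≡-Reasoning
    A : ℚ
    A = toℚ (a b (suc (2 ℕ.* k)))
    Q : ℕ
    Q = prodℕ (suc (2 ℕ.* k)) (λ i → b (suc i))
    zDigits≡ : toℚ (zDigits k) + 1ℚ ≡ A * D b (suc (2 ℕ.* k))
    zDigits≡ = trans (toℚ-zDigits+1 k) (sym (a*D≡alternatingSum (suc (2 ℕ.* k))))
    A*inv≡1 : A * inv Q ≡ 1ℚ
    A*inv≡1 = trans (cong (λ n → toℚ n * inv Q) (a≡prodℕ-tail (suc (2 ℕ.* k))))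
                    (toℚ*inv≡1 Q (1≤prodℕ (suc (2 ℕ.* k)) _ λ i → 1≤b (suc i)))

module ShiftedCopies where
  open import Data.Nat using (zero; _+_; _*_; _<_)
  open import Data.Nat.Properties
  open import Data.List using (List; []; _++_; map; length)
  open import Data.List.Properties using (length-++; length-map)
  open import Data.List.Membership.Propositional using (_∈_)
  open import Data.List.Membership.Propositional.Properties using (∈-++⁺ˡ; ∈-++⁺ʳ; ∈-++⁻; ∈-map⁺; ∈-map⁻)
  open import Data.List.Membership.Propositional.Properties.WithK using (unique∧set⇒bag)
  open import Data.List.Relation.Binary.BagAndSetEquality using (∼bag⇒↭)
  open import Data.List.Relation.Binary.Permutation.Propositional.Properties using (↭-length)
  open import Data.List.Relation.Unary.Unique.Propositional using (Unique)
  import Data.List.Relation.Unary.Unique.Propositional.Properties as Unique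
  open import Data.List.Relation.Unary.AllPairs using ([])
  open import Data.Product using (Σ; _×_; _,_)
  open import Data.Sum using (inj₁; inj₂)
  open import Data.Empty using (⊥)
  open import Function.Bundles using (mk⇔)
  open import Relation.Binary.PropositionalEquality

  same-members⇒length-≡ : ∀ {xs ys : List ℕ} → Unique xs → Unique ys →
                          (∀ s → s ∈ xs → s ∈ ys) → (∀ s → s ∈ ys → s ∈ xs) → length xs ≡ length ys
  same-members⇒length-≡ !xs !ys xs⊆ys ys⊆xs =
    ↭-length (∼bag⇒↭ (unique∧set⇒bag !xs !ys λ {s} → mk⇔ (xs⊆ys s) (ys⊆xs s)))

  shiftedCopies : ℕ → ℕ → List ℕ → List ℕ
  shiftedCopies w zero    xs = []
  shiftedCopies w (suc e) xs = shiftedCopies w e xs ++ map (_+ e * w) xs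

  length-shiftedCopies : ∀ w e xs → length (shiftedCopies w e xs) ≡ e * length xs
  length-shiftedCopies w zero    xs = refl
  length-shiftedCopies w (suc e) xs = begin
    length (shiftedCopies w e xs ++ map (_+ e * w) xs)
      ≡⟨ length-++ (shiftedCopies w e xs) ⟩
    length (shiftedCopies w e xs) + length (map (_+ e * w) xs)
      ≡⟨ cong₂ _+_ (length-shiftedCopies w e xs) (length-map _ xs) ⟩
    e * length xs + length xs
      ≡⟨ +-comm (e * length xs) (length xs) ⟩
    suc e * length xs
      ∎
    where open ≡-Reasoning

  ∈-shiftedCopies⁻ : ∀ w e xs {s} → s ∈ shiftedCopies w e xs →
                     Σ ℕ λ e′ → Σ ℕ λ s′ → e′ < e × s′ ∈ xs × s ≡ s′ + e′ * w
  ∈-shiftedCopies⁻ w (suc e) xs s∈ with ∈-++⁻ (shiftedCopies w e xs) s∈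
  ... | inj₁ s∈′ with ∈-shiftedCopies⁻ w e xs s∈′
  ...   | e′ , s′ , e′<e , s′∈ , s≡ = e′ , s′ , m<n⇒m<1+n e′<e , s′∈ , s≡
  ∈-shiftedCopies⁻ w (suc e) xs s∈ | inj₂ s∈′ with ∈-map⁻ (_+ e * w) s∈′
  ...   | s′ , s′∈ , s≡ = e , s′ , n<1+n e , s′∈ , s≡

  ∈-shiftedCopies⁺ : ∀ w e xs {e′ s′} → e′ < e → s′ ∈ xs → s′ + e′ * w ∈ shiftedCopies w e xs
  ∈-shiftedCopies⁺ w (suc e) xs e′<1+e s′∈ with m<1+n⇒m<n∨m≡n e′<1+e
  ... | inj₁ e′<e = ∈-++⁺ˡ (∈-shiftedCopies⁺ w e xs e′<e s′∈)
  ... | inj₂ refl = ∈-++⁺ʳ (shiftedCopies w e xs) (∈-map⁺ (_+ e * w) s′∈)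

  shiftedCopies-< : ∀ w e xs → (∀ x → x ∈ xs → x < w) → ∀ {s} → s ∈ shiftedCopies w e xs → s < e * w
  shiftedCopies-< w e xs xs<w s∈ with ∈-shiftedCopies⁻ w e xs s∈
  ... | e′ , s′ , e′<e , s′∈ , refl = begin-strict
    s′ + e′ * w   <⟨ +-monoˡ-< (e′ * w) (xs<w s′ s′∈) ⟩
    suc e′ * w    ≤⟨ *-monoˡ-≤ w e′<e ⟩
    e * w         ∎
    where open ≤-Reasoning

  shiftedCopies-unique : ∀ w e xs → (∀ x → x ∈ xs → x < w) → Unique xs → Unique (shiftedCopies w e xs)
  shiftedCopies-unique w zero    xs xs<w !xs = []
  shiftedCopies-unique w (suc e) xs xs<w !xs =
    Unique.++⁺ (shiftedCopies-unique w e xs xs<w !xs) (Unique.map⁺ (+-cancelʳ-≡ (e * w) _ _) !xs) disjoint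
    where
    disjoint : ∀ {v} → v ∈ shiftedCopies w e xs × v ∈ map (_+ e * w) xs → ⊥
    disjoint (v∈ˡ , v∈ʳ) with ∈-map⁻ (_+ e * w) v∈ʳ
    ... | s′ , _ , refl = <⇒≱ (shiftedCopies-< w e xs xs<w v∈ˡ) (m≤n+m (e * w) s′)

open import Data.Nat using (_*_)

module MixedRadix (c d : ℕ → ℕ) (1≤c₀ : 1 ≤ c 0) (2≤d : ∀ i → 2 ≤ d i)
                  (d*c≤c : ∀ i → d i * c i ≤ c (suc i)) where
  open import Defs using (sumℕ; prodℕ; CountIs)
  open import Data.Nat
  open import Data.Nat.Properties
  open import Data.List using (List; [_]; length)
  open import Data.List.Membership.Propositional using (_∈_)
  open import Data.List.Relation.Unary.Any using (here)
  open import Data.List.Relation.Unary.Unique.Propositional using (Unique)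
  import Data.List.Relation.Unary.All as All
  import Data.List.Relation.Unary.AllPairs as AllPairs
  open import Data.Product using (Σ; _×_; _,_; proj₁; proj₂)
  open import Relation.Nullary using (yes; no; contradiction)
  open import Relation.Binary.PropositionalEquality hiding ([_])
  open SumProperties
  open ShiftedCopies

  Representable : ℕ → Set
  Representable s = Σ ℕ λ n → Σ (ℕ → ℕ) λ ε →
    ((j : ℕ) → j ≤ n → ε j < d j) × (s ≡ sumℕ (suc n) (λ j → ε j * c j))

  Representable< : ℕ → ℕ → Set
  Representable< K s = Σ (ℕ → ℕ) λ ε →
    ((i : ℕ) → i < K → ε i < d i) × (s ≡ sumℕ K (λ i → ε i * c i))

  largest : ℕ → ℕ
  largest K = sumℕ K (λ i → (d i ∸ 1) * c i)

  0<d : ∀ i → 0 < d i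
  0<d i = <-trans z<s (2≤d i)

  c-mono : ∀ {i j} → i ≤ j → c i ≤ c j
  c-mono {i} {j} i≤j = subst (λ t → c i ≤ c t) (m∸n+n≡m i≤j) (c≤c[o+i] (j ∸ i))
    where
    c≤c[o+i] : ∀ o → c i ≤ c (o + i)
    c≤c[o+i] zero    = ≤-refl
    c≤c[o+i] (suc o) = ≤-trans (c≤c[o+i] o) (≤-trans (m≤n*m (c (o + i)) (d (o + i)) {{>-nonZero (0<d _)}}) (d*c≤c (o + i)))

  c+[d∸1]*c≡d*c : ∀ i → c i + (d i ∸ 1) * c i ≡ d i * c i
  c+[d∸1]*c≡d*c i with d i | 2≤d i
  ... | suc _ | _ = refl

  largest<c : ∀ K → largest K < c K

  largest[1+K]<d*c : ∀ K → largest (suc K) < d K * c K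
  largest[1+K]<d*c K = subst (largest (suc K) <_) (c+[d∸1]*c≡d*c K) (+-monoˡ-< ((d K ∸ 1) * c K) (largest<c K))

  largest<c zero    = 1≤c₀
  largest<c (suc K) = <-≤-trans (largest[1+K]<d*c K) (d*c≤c K)

  largest+c<2*c : ∀ K → largest K + c K < 2 * c K
  largest+c<2*c K = subst (largest K + c K <_) (cong (c K +_) (sym (+-identityʳ (c K)))) (+-monoˡ-< (c K) (largest<c K))

  cutAt : ℕ → (ℕ → ℕ) → ℕ → ℕ → ℕ
  cutAt K ε e i with i <? K
  ... | yes _ = ε i
  ... | no  _ = e

  cutAt-elim : ∀ (P : ℕ → Set) K ε e i → (i < K → P (ε i)) → (K ≤ i → P e) → P (cutAt K ε e i)
  cutAt-elim P K ε e i below above with i <? K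
  ... | yes i<K = below i<K
  ... | no  i≮K = above (≮⇒≥ i≮K)

  sumℕ-cutAt : ∀ K ε e → sumℕ (suc K) (λ i → cutAt K ε e i * c i) ≡ sumℕ K (λ i → ε i * c i) + e * c K
  sumℕ-cutAt K ε e = cong₂ _+_
    (sumℕ-cong K λ i i<K → cutAt-elim (λ t → t * c i ≡ ε i * c i) K ε e i (λ _ → refl) (λ K≤i → contradiction i<K (≤⇒≯ K≤i)))
    (cutAt-elim (λ t → t * c K ≡ e * c K) K ε e K (λ K<K → contradiction K<K (n≮n K)) (λ _ → refl))

  cutAt-digits : ∀ {K ε e} → (∀ i → i < K → ε i < d i) → e < d K → ∀ i → i < suc K → cutAt K ε e i < d i
  cutAt-digits {K} {ε} {e} ε<d e<d i i<1+K =
    cutAt-elim (_< d i) K ε e i (ε<d i) (λ K≤i → subst (λ j → e < d j) (≤-antisym K≤i (m<1+n⇒m≤n i<1+K)) e<d)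

  Representable<-suc⁺ : ∀ {K s e} → Representable< K s → e < d K → Representable< (suc K) (s + e * c K)
  Representable<-suc⁺ {K} {e = e} (ε , ε<d , refl) e<d = cutAt K ε e , cutAt-digits ε<d e<d , sym (sumℕ-cutAt K ε e)

  Representable<-suc⁻ : ∀ {K s} → Representable< (suc K) s →
                        Σ ℕ λ s′ → Σ ℕ λ e → Representable< K s′ × e < d K × s ≡ s′ + e * c K
  Representable<-suc⁻ {K} (ε , ε<d , s≡) = _ , ε K , (ε , (λ i i<K → ε<d i (m<n⇒m<1+n i<K)) , refl) , ε<d K (n<1+n K) , s≡

  Representable<⇒≤largest : ∀ {K s} → Representable< K s → s ≤ largest K
  Representable<⇒≤largest {K} (ε , ε<d , refl) = sumℕ-mono-≤ K λ i i<K → *-monoˡ-≤ (c i) (pred-mono-≤ (ε<d i i<K))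

  Representable<⇒Representable : ∀ {K s} → Representable< K s → Representable s
  Representable<⇒Representable {K} (ε , ε<d , refl) =
    K , cutAt K ε 0 , (λ j j≤K → cutAt-digits ε<d (0<d K) j (s≤s j≤K)) ,
    sym (trans (sumℕ-cutAt K ε 0) (+-identityʳ _))

  m*n<n⇒m≡0 : ∀ m n → m * n < n → m ≡ 0
  m*n<n⇒m≡0 zero    n _  = refl
  m*n<n⇒m≡0 (suc m) n mn<n = contradiction (m≤m+n n (m * n)) (<⇒≱ mn<n)

  -- Below c K every digit from position K on vanishes, since a nonzero one already contributes c j ≥ c K.
  Representable⇒Representable< : ∀ {K s} → Representable s → s < c K → Representable< K s
  Representable⇒Representable< {K} {s} (n , ε , ε<d , s≡) s<cK = ε′ , ε′<d , (begin
    s                                  ≡⟨ s≡ ⟩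
    sumℕ (suc n) (λ j → ε j * c j)     ≡⟨ sumℕ-cong (suc n) (λ j j<1+n → cong (_* c j) (ε′≡ε j<1+n)) ⟨
    sumℕ (suc n) f                     ≡⟨ sumℕ-vanishing f≡0-from-1+n (m≤m+n (suc n) K) ⟨
    sumℕ (suc n + K) f                 ≡⟨ sumℕ-vanishing f≡0-from-K (m≤n+m K (suc n)) ⟩
    sumℕ K f                           ∎)
    where
    open ≡-Reasoning
    ε′ : ℕ → ℕ
    ε′ = cutAt (suc n) ε 0
    f : ℕ → ℕ
    f j = ε′ j * c j
    ε′≡ε : ∀ {j} → j < suc n → ε′ j ≡ ε j
    ε′≡ε {j} j<1+n = cutAt-elim (_≡ ε j) (suc n) ε 0 j (λ _ → refl) (λ 1+n≤j → contradiction j<1+n (≤⇒≯ 1+n≤j))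
    ε′<d : ∀ i → i < K → ε′ i < d i
    ε′<d i _ = cutAt-elim (_< d i) (suc n) ε 0 i (λ i<1+n → ε<d i (m<1+n⇒m≤n i<1+n)) (λ _ → 0<d i)
    f≡0-from-1+n : ∀ j → suc n ≤ j → f j ≡ 0
    f≡0-from-1+n j 1+n≤j =
      cutAt-elim (λ t → t * c j ≡ 0) (suc n) ε 0 j (λ j<1+n → contradiction j<1+n (≤⇒≯ 1+n≤j)) (λ _ → refl)
    ε*c≤s : ∀ {j} → j < suc n → ε j * c j ≤ s
    ε*c≤s {j} j<1+n = subst (ε j * c j ≤_) (sym s≡) (term≤sumℕ (suc n) (λ i → ε i * c i) j<1+n)
    f≡0-from-K : ∀ j → K ≤ j → f j ≡ 0
    f≡0-from-K j K≤j = cutAt-elim (λ t → t * c j ≡ 0) (suc n) ε 0 j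
      (λ j<1+n → cong (_* c j) (m*n<n⇒m≡0 (ε j) (c j) (≤-<-trans (ε*c≤s j<1+n) (<-≤-trans s<cK (c-mono K≤j)))))
      (λ _ → refl)

  representables : ℕ → List ℕ
  representables zero    = [ 0 ]
  representables (suc K) = shiftedCopies (c K) (d K) (representables K)

  ∈-representables⁻ : ∀ K {s} → s ∈ representables K → Representable< K s
  ∈-representables⁻ zero    (here refl) = (λ _ → 0) , (λ i ()) , refl
  ∈-representables⁻ (suc K) s∈ with ∈-shiftedCopies⁻ (c K) (d K) (representables K) s∈
  ... | e , s′ , e<d , s′∈ , refl = Representable<-suc⁺ (∈-representables⁻ K s′∈) e<d

  ∈-representables⁺ : ∀ K {s} → Representable< K s → s ∈ representables K
  ∈-representables⁺ zero    (ε , ε<d , refl) = here refl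
  ∈-representables⁺ (suc K) r with Representable<-suc⁻ r
  ... | s′ , e , r′ , e<d , refl = ∈-shiftedCopies⁺ (c K) (d K) (representables K) e<d (∈-representables⁺ K r′)

  representables-< : ∀ K s → s ∈ representables K → s < c K
  representables-< K s s∈ = ≤-<-trans (Representable<⇒≤largest (∈-representables⁻ K s∈)) (largest<c K)

  representables-unique : ∀ K → Unique (representables K)
  representables-unique zero    = All.[] AllPairs.∷ AllPairs.[]
  representables-unique (suc K) =
    shiftedCopies-unique (c K) (d K) (representables K) (representables-< K) (representables-unique K)

  length-representables : ∀ K → length (representables K) ≡ prodℕ K d
  length-representables zero    = refl
  length-representables (suc K) = begin
    length (shiftedCopies (c K) (d K) (representables K)) ≡⟨ length-shiftedCopies (c K) (d K) (representables K) ⟩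
    d K * length (representables K)                      ≡⟨ cong (d K *_) (length-representables K) ⟩
    d K * prodℕ K d                                      ≡⟨ *-comm (d K) (prodℕ K d) ⟩
    prodℕ K d * d K                                      ∎
    where open ≡-Reasoning

  -- The representable s ≤ x are exactly the s′ + e′ c K with s′ written in the first K digits and e′ ≤ e.
  count-between : ∀ {K e x n} → e < d K → largest K + e * c K ≤ x → x < suc e * c K →
                  CountIs Representable x n → n ≡ suc e * prodℕ K d
  count-between {K} {e} {x} e<d lo hi (L , !L , refl , L≡) = begin
    length L                           ≡⟨ same-members⇒length-≡ !L !copies L⊆copies copies⊆L ⟩
    length copies                      ≡⟨ length-shiftedCopies (c K) (suc e) (representables K) ⟩
    suc e * length (representables K)  ≡⟨ cong (suc e *_) (length-representables K) ⟩
    suc e * prodℕ K d                  ∎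
    where
    open ≡-Reasoning
    copies : List ℕ
    copies = shiftedCopies (c K) (suc e) (representables K)
    !copies : Unique copies
    !copies = shiftedCopies-unique (c K) (suc e) (representables K) (representables-< K) (representables-unique K)
    x<c[1+K] : x < c (suc K)
    x<c[1+K] = <-≤-trans hi (≤-trans (*-monoˡ-≤ (c K) e<d) (d*c≤c K))
    L⊆copies : ∀ s → s ∈ L → s ∈ copies
    L⊆copies s s∈L with proj₁ (L≡ s) s∈L
    ... | r , s≤x with Representable<-suc⁻ (Representable⇒Representable< r (≤-<-trans s≤x x<c[1+K]))
    ...   | s′ , e′ , r′ , _ , refl =
      ∈-shiftedCopies⁺ (c K) (suc e) (representables K) e′<1+e (∈-representables⁺ K r′)
      where
      e′<1+e : e′ < suc e
      e′<1+e = *-cancelʳ-< (c K) e′ (suc e) (≤-<-trans (≤-trans (m≤n+m (e′ * c K) s′) s≤x) hi)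
    copies⊆L : ∀ s → s ∈ copies → s ∈ L
    copies⊆L s s∈ with ∈-shiftedCopies⁻ (c K) (suc e) (representables K) s∈
    ... | e′ , s′ , e′<1+e , s′∈ , refl = proj₂ (L≡ _) (Representable<⇒Representable r , s≤x)
      where
      r : Representable< (suc K) (s′ + e′ * c K)
      r = Representable<-suc⁺ (∈-representables⁻ K s′∈) (≤-<-trans (m<1+n⇒m≤n e′<1+e) e<d)
      s≤x : s′ + e′ * c K ≤ x
      s≤x = ≤-trans (+-mono-≤ (Representable<⇒≤largest (∈-representables⁻ K s′∈)) (*-monoˡ-≤ (c K) (m<1+n⇒m≤n e′<1+e))) lo

  count-below : ∀ {K x n} → largest K ≤ x → x < c K → CountIs Representable x n → n ≡ prodℕ K d
  count-below {K} {x} lo hi C = trans (count-between (0<d K) (subst (_≤ x) (sym (+-identityʳ (largest K))) lo)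
                                             (subst (x <_) (sym (+-identityʳ (c K))) hi) C)
                                      (*-identityˡ (prodℕ K d))

  count-largest+c : ∀ {K n} → CountIs Representable (largest K + c K) n → n ≡ 2 * prodℕ K d
  count-largest+c {K} = count-between (2≤d K) (≤-reflexive (cong (largest K +_) (+-identityʳ (c K)))) (largest+c<2*c K)

module DigitSets (b : ℕ → ℕ) (b₀≡1 : b 0 ≡ 1) (2≤b : ∀ j → 1 ≤ j → 2 ≤ b j) where
  open import Defs
  open import Data.Nat
  open import Data.Nat.Properties
  open import Data.Nat.Solver using (module +-*-Solver)
  open import Relation.Binary.PropositionalEquality
  open SumProperties using (1≤prodℕ)
  open +-*-Solver

  1≤b : ∀ j → 1 ≤ b j
  1≤b zero    = ≤-reflexive (sym b₀≡1)
  1≤b (suc j) = ≤-trans (s≤s z≤n) (2≤b (suc j) (s≤s z≤n))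

  1≤a : ∀ j → 1 ≤ a b j
  1≤a j = 1≤prodℕ (suc j) b 1≤b

  a[j]≤a[1+j] : ∀ j → a b j ≤ a b (suc j)
  a[j]≤a[1+j] j = m≤m*n (a b j) (b (suc j)) {{>-nonZero (1≤b (suc j))}}

  2*a[j]≤a[1+j] : ∀ j → 2 * a b j ≤ a b (suc j)
  2*a[j]≤a[1+j] j = ≤-trans (≤-reflexive (*-comm 2 (a b j))) (*-monoʳ-≤ (a b j) (2≤b (suc j) (s≤s z≤n)))

  cA dA cB dB : ℕ → ℕ
  cA i = a b (2 * i)
  dA i = b (suc (2 * i))
  cB i = a b (suc (2 * i))
  dB i = b (2 + 2 * i)

  a[2+2k]≡cA[1+k] : ∀ k → a b (2 + 2 * k) ≡ cA (suc k)
  a[2+2k]≡cA[1+k] k = cong (a b) (sym (*-suc 2 k))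

  dA*cA≡cB : ∀ i → dA i * cA i ≡ cB i
  dA*cA≡cB i = *-comm (dA i) (cA i)

  dB*cB≡cA : ∀ i → dB i * cB i ≡ cA (suc i)
  dB*cB≡cA i = trans (*-comm (dB i) (cB i)) (a[2+2k]≡cA[1+k] i)

  module A = MixedRadix cA dA (1≤a 0) (λ i → 2≤b _ (s≤s z≤n))
    (λ i → subst (dA i * cA i ≤_) (a[2+2k]≡cA[1+k] i) (≤-trans (≤-reflexive (dA*cA≡cB i)) (a[j]≤a[1+j] (suc (2 * i)))))
  module B = MixedRadix cB dB (1≤a 1) (λ i → 2≤b _ (s≤s z≤n))
    (λ i → ≤-trans (≤-reflexive (dB*cB≡cA i)) (a[j]≤a[1+j] (2 * suc i)))

  prodA*prodB≡a : ∀ k → prodℕ k dA * prodℕ k dB ≡ a b (2 * k)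
  prodA*prodB≡a zero    = sym (trans (*-identityˡ (b 0)) b₀≡1)
  prodA*prodB≡a (suc k) = begin
    prodℕ k dA * dA k * (prodℕ k dB * dB k)
      ≡⟨ solve 4 (λ p x q w → p :* x :* (q :* w) := p :* q :* x :* w) refl (prodℕ k dA) (dA k) (prodℕ k dB) (dB k) ⟩
    prodℕ k dA * prodℕ k dB * dA k * dB k   ≡⟨ cong (λ t → t * dA k * dB k) (prodA*prodB≡a k) ⟩
    a b (2 + 2 * k)                         ≡⟨ a[2+2k]≡cA[1+k] k ⟩
    a b (2 * suc k)                         ∎
    where open ≡-Reasoning

  -- y_k = largest_A(k) + a_{2k} lies in the B-window [largest_B(k), a_{2k+1}).
  count-at-y : ∀ k → 1 ≤ k → ∀ {nA nB} → CountIs (inA b) (y b k) nA → CountIs (inB b) (y b k) nB →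
               nA * nB ≡ 2 * a b (2 * k)
  count-at-y (suc k) _ {nA} {nB} CA CB = begin
    nA * nB
      ≡⟨ cong₂ _*_ (A.count-largest+c {K = suc k} CA) (B.count-below {K = suc k} lo hi CB) ⟩
    2 * prodℕ (suc k) dA * prodℕ (suc k) dB          ≡⟨ *-assoc 2 (prodℕ (suc k) dA) (prodℕ (suc k) dB) ⟩
    2 * (prodℕ (suc k) dA * prodℕ (suc k) dB)        ≡⟨ cong (2 *_) (prodA*prodB≡a (suc k)) ⟩
    2 * a b (2 * suc k)                              ∎
    where
    open ≡-Reasoning
    lo : B.largest (suc k) ≤ y b (suc k)
    lo = ≤-trans (<⇒≤ (B.largest[1+K]<d*c k)) (subst (_≤ y b (suc k)) (sym (dB*cB≡cA k)) (m≤n+m (cA (suc k)) _))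
    hi : y b (suc k) < cB (suc k)
    hi = <-≤-trans (A.largest+c<2*c (suc k)) (2*a[j]≤a[1+j] (2 * suc k))

  -- z_k = largest_B(k) + a_{2k+1} lies in the A-window [largest_A(k+1), a_{2k+2}).
  count-at-z : ∀ k {nA nB} → CountIs (inA b) (z b k) nA → CountIs (inB b) (z b k) nB →
               nA * nB ≡ 2 * a b (suc (2 * k))
  count-at-z k {nA} {nB} CA CB = begin
    nA * nB
      ≡⟨ cong₂ _*_ (A.count-below {K = suc k} lo hi CA) (B.count-largest+c {K = k} CB) ⟩
    prodℕ k dA * dA k * (2 * prodℕ k dB)
      ≡⟨ solve 3 (λ p x q → p :* x :* (con 2 :* q) := con 2 :* (p :* q :* x)) refl (prodℕ k dA) (dA k) (prodℕ k dB) ⟩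
    2 * (prodℕ k dA * prodℕ k dB * dA k)     ≡⟨ cong (λ t → 2 * (t * dA k)) (prodA*prodB≡a k) ⟩
    2 * a b (suc (2 * k))                    ∎
    where
    open ≡-Reasoning
    lo : A.largest (suc k) ≤ z b k
    lo = ≤-trans (<⇒≤ (A.largest[1+K]<d*c k)) (subst (_≤ z b k) (sym (dA*cA≡cB k)) (m≤n+m (cB k) _))
    hi : z b k < cA (suc k)
    hi = <-≤-trans (B.largest+c<2*c k) (subst (2 * cB k ≤_) (a[2+2k]≡cA[1+k] k) (2*a[j]≤a[1+j] (suc (2 * k))))

open import Defs
open import Data.Rational using (_÷_; _+_; 1ℚ; NonZero)
open import Data.Product using (_×_; _,_)
open import Relation.Binary.PropositionalEquality using (cong; trans)

lemma3p2 : (b : ℕ → ℕ) → b 0 ≡ 1 → ((j : ℕ) → 1 ≤ j → 2 ≤ b j) →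
    (k : ℕ) → 1 ≤ k →
    ((cA cB : ℕ) → CountIs (inA b) (y b k) cA → CountIs (inB b) (y b k) cB →
      (nz₁ : NonZero (toℚ (y b k))) → (nz₂ : NonZero (1ℚ + D b (2 * k))) →
      _÷_ (toℚ (cA * cB)) (toℚ (y b k)) {{nz₁}} ≡ _÷_ (toℚ 2) (1ℚ + D b (2 * k)) {{nz₂}}) ×
    ((cA cB : ℕ) → CountIs (inA b) (z b k) cA → CountIs (inB b) (z b k) cB →
      (nz₁ : NonZero (toℚ (z b k))) → (nz₂ : NonZero (1ℚ + Dstar b k)) →
      _÷_ (toℚ (cA * cB)) (toℚ (z b k)) {{nz₁}} ≡ _÷_ (toℚ 2) (1ℚ + Dstar b k) {{nz₂}})
lemma3p2 b b₀≡1 2≤b k 1≤k =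
  (λ _ _ CA CB nz₁ nz₂ → trans (cong (λ n → _÷_ (toℚ n) (toℚ (y b k)) {{nz₁}}) (count-at-y k 1≤k CA CB))
                               (toℚ-*-÷-cancel 2 (a b (2 * k)) (y b k) (y≡a*[1+D] k) {{nz₁}} {{nz₂}})) ,
  (λ _ _ CA CB nz₁ nz₂ → trans (cong (λ n → _÷_ (toℚ n) (toℚ (z b k)) {{nz₁}}) (count-at-z k CA CB))
                               (toℚ-*-÷-cancel 2 (a b (suc (2 * k))) (z b k) (z≡a*[1+D*] k) {{nz₁}} {{nz₂}}))
  where
  open DigitSets b b₀≡1 2≤b using (1≤b; count-at-y; count-at-z)
  open AlternatingSums b b₀≡1 1≤b using (y≡a*[1+D]; z≡a*[1+D*])
  open ToℚProperties using (toℚ-*-÷-cancel)
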